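{- Let $\bm\lambda=(R_1,\dots,R_n)$ be a horizontal-strip and $i\ne j$. (1) If $i<j$, then $R_i\prec R_j$ if and only if $R_i\subseteq R_j$ or $R_i\subseteq R_j^+$. (2) If $i>j$, then $R_i\prec R_j$ if and only if $R_i\subseteq R_j$ or $R_i\subseteq R_j^-$. (3) We have $R_i\prec R_j$ and $R_i\leftrightarrow R_j$ if and only if $R_i\subseteq R_j$.
   Context: A row is $R=a/b=\{(1,j):b+1\le j\le a\}$ ($a\ge b\ge0$ integers); $l(R)=b$, $|R|$ its number of cells, $R^+=(a+1)/(b+1)$, $R^-=(a-1)/(b-1)$; containment is containment of sets of cells. For rows $R,R'$: $M(R,R')=|R\cap R'|$ if $l(R)\le l(R')$, else $M(R,R')=|R\cap R'^+|$. Rows commute, $R\leftrightarrow R'$, if $M(R,R')=M(R',R)$. A horizontal-strip is a sequence of rows $(R_1,\dots,R_n)$; for $i\ne j$, $M_{i,j}=M(R_{\min(i,j)},R_{\max(i,j)})$, and $R_i\prec R_j$ means $M_{i,j}=|R_i|$. -}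

module Defs where

open import Data.Nat using (ℕ; suc; _∸_; _≤_; _<_; _≤?_; _<?_)
open import Data.Nat.Properties using (∸-monoˡ-≤)
open import Data.Product using (_×_)
open import Data.List using (List; upTo; filter; length)
open import Data.Fin using (Fin; toℕ)
open import Relation.Nullary using (Dec)
open import Relation.Nullary.Decidable using (_×-dec_)
open import Relation.Binary.PropositionalEquality using (_≡_)

-- A row  a/b = {(1,j) : b+1 ≤ j ≤ a}  with  a ≥ b ≥ 0.
record Row : Set where
  constructor _/_⟨_⟩
  field
    top  : ℕ
    len  : ℕ
    len≤top : len ≤ top
open Row public

-- the row lies in row 1; a cell (1,j) is identified with its column j.
_∈R_ : ℕ → Row → Set
j ∈R R = len R < j × j ≤ top R

_∈R?_ : (j : ℕ) → (R : Row) → Dec (j ∈R R)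
j ∈R? R = (len R <? j) ×-dec (j ≤? top R)

_⊆R_ : Row → Row → Set
R ⊆R R' = ∀ j → j ∈R R → j ∈R R'

-- |R| : number of cells (all cells have column ≤ top R)
∣_∣R : Row → ℕ
∣ R ∣R = length (filter (λ j → j ∈R? R) (upTo (suc (top R))))

∣_∩_∣R : Row → Row → ℕ
∣ R ∩ R' ∣R = length (filter (λ j → (j ∈R? R) ×-dec (j ∈R? R')) (upTo (suc (top R))))

l : Row → ℕ
l = len

_⁺ : Row → Row
(a / b ⟨ p ⟩) ⁺ = suc a / suc b ⟨ Data.Nat.s≤s p ⟩

_⁻ : Row → Row
(a / b ⟨ p ⟩) ⁻ = (a ∸ 1) / (b ∸ 1) ⟨ ∸-monoˡ-≤ 1 p ⟩

M : Row → Row → ℕ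
M R R' with l R ≤? l R'
... | Relation.Nullary.yes _ = ∣ R ∩ R' ∣R
... | Relation.Nullary.no  _ = ∣ R ∩ (R' ⁺) ∣R

_↔R_ : Row → Row → Set
R ↔R R' = M R R' ≡ M R' R

HorizontalStrip : ℕ → Set
HorizontalStrip n = Fin n → Row

Mᵢⱼ : ∀ {n} → HorizontalStrip n → Fin n → Fin n → ℕ
Mᵢⱼ λs i j with toℕ i ≤? toℕ j
... | Relation.Nullary.yes _ = M (λs i) (λs j)
... | Relation.Nullary.no  _ = M (λs j) (λs i)

Prec : ∀ {n} → HorizontalStrip n → Fin n → Fin n → Set
Prec λs i j = Mᵢⱼ λs i j ≡ ∣ λs i ∣R

{-# OPTIONS --safe #-}
-- M(R,S) counts the cells of R lying in S or in S⁺, and such a count equals |R| exactly when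
-- every cell of R qualifies; so for R before S, R ≺ S means R ⊆ S (if l R ≤ l S) or R ⊆ S⁺
-- (if l S < l R).  For R after S, symmetry of intersections and |R⁺| = |R| turn R ≺ S into
-- R ⊆ S or R⁺ ⊆ S, and R⁺ ⊆ S is R ⊆ S⁻.  In each case the missing disjunct is implied or
-- vacuous, since a row contained in a row starting later is empty.  Part (3) follows because
-- R ⊆ S⁺ and R ⊆ S⁻ together already force R ⊆ S.
module Submission where

open import Defs
open import Data.Nat using (ℕ; zero; suc; _+_; _∸_; _≤_; _<_; _≤?_; s≤s; z≤n)
open import Data.Nat.Properties
  using (≤-refl; ≤-trans; <-≤-trans; ≤-<-trans; <⇒≤; <⇒≱; ≤-pred; m≤m+n; m∸n≤m; m≤n⇒m≤1+n;
         m≤n+m∸n; ∸-monoˡ-≤; +-suc; +-comm; +-identityʳ; ≤-<-connex)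
open import Data.Fin using (Fin; toℕ)
open import Data.List using ([]; _∷_; [_]; _++_; _∷ʳ_; length; filter; map; applyUpTo; upTo)
open import Data.List.Properties
  using (filter-accept; filter-reject; filter-complete; filter-all; filter-++; filter-≐;
         ++-identityʳ; upTo-∷ʳ; map-applyUpTo; length-map)
open import Data.List.Membership.Propositional using (_∈_)
open import Data.List.Membership.Propositional.Properties using (∈-filter⁺; ∈-filter⁻; ∈-upTo⁺)
open import Data.List.Relation.Unary.All as All using (All)
open import Data.List.Relation.Unary.All.Properties using (all-filter)
open import Data.Product using (_×_; _,_; proj₁; proj₂; swap)
open import Data.Sum using (_⊎_; inj₁; inj₂; [_,_]′)
open import Function using (_∘_; id)
open import Function.Bundles using (_⇔_; mk⇔; Equivalence)
import Function.Properties.Equivalence as ⇔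
open import Level using (0ℓ)
open import Relation.Nullary using (yes; no; contradiction)
open import Relation.Unary using (Pred; Decidable; _≐_)
open import Relation.Unary.Properties using (_∩?_)
open import Relation.Binary.PropositionalEquality
  using (_≡_; _≢_; refl; sym; trans; cong; subst; module ≡-Reasoning)
import Relation.Binary.Reasoning.Setoid as SetoidReasoning

open Equivalence using (to; from)

module _ {a p q} {A : Set a} {P : Pred A p} {Q : Pred A q}
         (P? : Decidable P) (Q? : Decidable Q) where

  filter-∩ : ∀ xs → filter (P? ∩? Q?) xs ≡ filter Q? (filter P? xs)
  filter-∩ [] = refl
  filter-∩ (x ∷ xs) with P? x | Q? x
  ... | yes _ | yes Qx = trans (cong (x ∷_) (filter-∩ xs)) (sym (filter-accept Q? Qx))
  ... | yes _ | no ¬Qx = trans (filter-∩ xs) (sym (filter-reject Q? ¬Qx))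
  ... | no _  | _      = filter-∩ xs

  length-filter-∩⇔ : ∀ xs → length (filter (P? ∩? Q?) xs) ≡ length (filter P? xs)
                            ⇔ (∀ {x} → x ∈ xs → P x → Q x)
  length-filter-∩⇔ xs = mk⇔ ⇒ ⇐
    where
    ys = filter P? xs
    ⇒ : length (filter (P? ∩? Q?) xs) ≡ length ys → ∀ {x} → x ∈ xs → P x → Q x
    ⇒ eq x∈xs Px = All.lookup all-Q (∈-filter⁺ P? x∈xs Px)
      where
      all-Q : All Q ys
      all-Q = subst (All Q) (filter-complete Q? (trans (sym (cong length (filter-∩ xs))) eq))
                    (all-filter Q? ys)
    ⇐ : (∀ {x} → x ∈ xs → P x → Q x) → length (filter (P? ∩? Q?) xs) ≡ length ys
    ⇐ P⇒Q = begin
      length (filter (P? ∩? Q?) xs) ≡⟨ cong length (filter-∩ xs) ⟩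
      length (filter Q? ys)         ≡⟨ cong length (filter-all Q? all-Q) ⟩
      length ys                     ∎
      where
      open ≡-Reasoning
      all-Q : All Q ys
      all-Q = All.tabulate λ x∈ys → let x∈xs , Px = ∈-filter⁻ P? x∈ys in P⇒Q x∈xs Px

filter-map : ∀ {a b p} {A : Set a} {B : Set b} {P : Pred B p}
             (f : A → B) (P? : Decidable P) xs →
             filter P? (map f xs) ≡ map f (filter (P? ∘ f) xs)
filter-map f P? [] = refl
filter-map f P? (x ∷ xs) with P? (f x)
... | yes _ = cong (f x ∷_) (filter-map f P? xs)
... | no _  = filter-map f P? xs

filter-upTo-+ : ∀ {p} {P : Pred ℕ p} (P? : Decidable P) {m} →
                (∀ {x} → P x → x < m) → ∀ k → filter P? (upTo (m + k)) ≡ filter P? (upTo m)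
filter-upTo-+ P? {m} P⇒<m zero = cong (filter P? ∘ upTo) (+-identityʳ m)
filter-upTo-+ P? {m} P⇒<m (suc k) = begin
  filter P? (upTo (m + suc k))                 ≡⟨ cong (filter P? ∘ upTo) (+-suc m k) ⟩
  filter P? (upTo (suc (m + k)))               ≡⟨ cong (filter P?) (sym (upTo-∷ʳ (m + k))) ⟩
  filter P? (upTo (m + k) ∷ʳ (m + k))          ≡⟨ filter-++ P? (upTo (m + k)) [ m + k ] ⟩
  filter P? (upTo (m + k)) ++ filter P? [ m + k ]
    ≡⟨ cong (filter P? (upTo (m + k)) ++_) (filter-reject P? (λ P[m+k] → <⇒≱ (P⇒<m P[m+k]) (m≤m+n m k))) ⟩
  filter P? (upTo (m + k)) ++ []               ≡⟨ ++-identityʳ _ ⟩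
  filter P? (upTo (m + k))                     ≡⟨ filter-upTo-+ P? P⇒<m k ⟩
  filter P? (upTo m)                           ∎
  where open ≡-Reasoning

∣∩∣R≡∣∣R⇔⊆R : ∀ R S → ∣ R ∩ S ∣R ≡ ∣ R ∣R ⇔ R ⊆R S
∣∩∣R≡∣∣R⇔⊆R R S = ⇔.trans (length-filter-∩⇔ (_∈R? R) (_∈R? S) (upTo (suc (top R))))
  (mk⇔ (λ ⊆ᵤ j j∈R → ⊆ᵤ (∈-upTo⁺ (s≤s (proj₂ j∈R))) j∈R) (λ R⊆S {j} _ → R⊆S j))

∣∩∣R-comm : ∀ R S → ∣ R ∩ S ∣R ≡ ∣ S ∩ R ∣R
∣∩∣R-comm R S = begin
  length (filter R∩S? (upTo (suc (top R))))
    ≡⟨ cong length (filter-upTo-+ R∩S? (s≤s ∘ proj₂ ∘ proj₁) (top S)) ⟨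
  length (filter R∩S? (upTo (suc (top R + top S))))
    ≡⟨ cong (length ∘ filter R∩S? ∘ upTo ∘ suc) (+-comm (top R) (top S)) ⟩
  length (filter R∩S? (upTo (suc (top S + top R))))
    ≡⟨ cong length (filter-≐ R∩S? S∩R? (swap , swap) (upTo (suc (top S + top R)))) ⟩
  length (filter S∩R? (upTo (suc (top S + top R))))
    ≡⟨ cong length (filter-upTo-+ S∩R? (s≤s ∘ proj₂ ∘ proj₁) (top R)) ⟩
  length (filter S∩R? (upTo (suc (top S))))
    ∎
  where
  open ≡-Reasoning
  R∩S? = (_∈R? R) ∩? (_∈R? S)
  S∩R? = (_∈R? S) ∩? (_∈R? R)

∣⁺∣R : ∀ R → ∣ R ⁺ ∣R ≡ ∣ R ∣R
∣⁺∣R R = begin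
  -- column 0 is not a cell of R ⁺, and the filter discards it by computation
  ∣ R ⁺ ∣R                                                        ≡⟨⟩
  length (filter (_∈R? (R ⁺)) (applyUpTo suc (suc (top R))))
    ≡⟨ cong (length ∘ filter (_∈R? (R ⁺))) (map-applyUpTo id suc (suc (top R))) ⟨
  length (filter (_∈R? (R ⁺)) (map suc cols))                    ≡⟨ cong length (filter-map suc (_∈R? (R ⁺)) cols) ⟩
  length (map suc (filter shifted? cols))                        ≡⟨ length-map suc (filter shifted? cols) ⟩
  length (filter shifted? cols)                                  ≡⟨ cong length (filter-≐ shifted? (_∈R? R) shift cols) ⟩
  length (filter (_∈R? R) cols)                                  ∎
  where
  open ≡-Reasoning
  cols = upTo (suc (top R))
  shifted? : Decidable (λ j → suc j ∈R (R ⁺))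
  shifted? j = suc j ∈R? (R ⁺)
  shift : (λ j → suc j ∈R (R ⁺)) ≐ (_∈R R)
  shift = (λ (lR<j , j≤top) → ≤-pred lR<j , ≤-pred j≤top) , (λ (lR<j , j≤top) → s≤s lR<j , s≤s j≤top)

-- Such an R has no cells: its first column, len R + 1, would lie in S.
⊆R-later⇒empty : ∀ R S T → R ⊆R S → len R < len S → R ⊆R T
⊆R-later⇒empty R S T R⊆S lR<lS j (lR<j , j≤top) =
  contradiction (≤-pred (proj₁ (R⊆S (suc (len R)) (≤-refl , <-≤-trans lR<j j≤top)))) (<⇒≱ lR<lS)

⊆R⇒⊆R⁺ : ∀ R S → len S < len R → R ⊆R S → R ⊆R (S ⁺)
⊆R⇒⊆R⁺ R S lS<lR R⊆S j j∈R@(lR<j , _) = <-≤-trans (s≤s lS<lR) lR<j , m≤n⇒m≤1+n (proj₂ (R⊆S j j∈R))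

⊆R⁻⇒⊆R : ∀ R S → len S ≤ len R → R ⊆R (S ⁻) → R ⊆R S
⊆R⁻⇒⊆R R S lS≤lR R⊆S⁻ j j∈R@(lR<j , _) = ≤-<-trans lS≤lR lR<j , ≤-trans (proj₂ (R⊆S⁻ j j∈R)) (m∸n≤m (top S) 1)

⊆R⁺×⊆R⁻⇒⊆R : ∀ R S → R ⊆R (S ⁺) → R ⊆R (S ⁻) → R ⊆R S
⊆R⁺×⊆R⁻⇒⊆R R S R⊆S⁺ R⊆S⁻ j j∈R = <⇒≤ (proj₁ (R⊆S⁺ j j∈R)) , ≤-trans (proj₂ (R⊆S⁻ j j∈R)) (m∸n≤m (top S) 1)

-- Only columns ≥ 1 occur (cells lie above len R), and there the truncated S ⁻ is the exact shift of S.
⁺⊆R⇔⊆R⁻ : ∀ R S → (R ⁺) ⊆R S ⇔ R ⊆R (S ⁻)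
⁺⊆R⇔⊆R⁻ R S = mk⇔ ⇒ ⇐
  where
  ⇒ : (R ⁺) ⊆R S → R ⊆R (S ⁻)
  ⇒ R⁺⊆S (suc k) (lR<1+k , 1+k≤top) =
    let lS<2+k , 2+k≤top = R⁺⊆S (suc (suc k)) (s≤s lR<1+k , s≤s 1+k≤top)
    in s≤s (∸-monoˡ-≤ 1 (≤-pred lS<2+k)) , ∸-monoˡ-≤ 1 2+k≤top
  ⇐ : R ⊆R (S ⁻) → (R ⁺) ⊆R S
  ⇐ R⊆S⁻ (suc k) (1+lR<1+k , 1+k≤1+top) =
    let lS∸1<k , k≤top∸1 = R⊆S⁻ k (≤-pred 1+lR<1+k , ≤-pred 1+k≤1+top)
    in s≤s (≤-trans (m≤n+m∸n (len S) 1) lS∸1<k) , suc-≤ (top S) (≤-<-trans z≤n lS∸1<k) k≤top∸1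
    where
    suc-≤ : ∀ n {k} → 0 < k → k ≤ n ∸ 1 → suc k ≤ n
    suc-≤ zero 0<k k≤0 = contradiction k≤0 (<⇒≱ 0<k)
    suc-≤ (suc n) _ k≤n = s≤s k≤n

M-≤ : ∀ R S → len R ≤ len S → M R S ≡ ∣ R ∩ S ∣R
M-≤ R S lR≤lS with len R ≤? len S
... | yes _     = refl
... | no lR≰lS = contradiction lR≤lS lR≰lS

M-> : ∀ R S → len S < len R → M R S ≡ ∣ R ∩ (S ⁺) ∣R
M-> R S lS<lR with len R ≤? len S
... | yes lR≤lS = contradiction lR≤lS (<⇒≱ lS<lR)
... | no _      = refl

≡-congˡ-⇔ : ∀ {a} {A : Set a} {x y z : A} → x ≡ y → (x ≡ z) ⇔ (y ≡ z)
≡-congˡ-⇔ x≡y = mk⇔ (trans (sym x≡y)) (trans x≡y)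

≡-congʳ-⇔ : ∀ {a} {A : Set a} {x y z : A} → y ≡ z → (x ≡ y) ⇔ (x ≡ z)
≡-congʳ-⇔ y≡z = mk⇔ (λ x≡y → trans x≡y y≡z) (λ x≡z → trans x≡z (sym y≡z))

module ⇔-Reasoning = SetoidReasoning (⇔.⇔-setoid 0ℓ)

M≡∣∣R⇔⊆R⊎⊆R⁺ : ∀ R S → M R S ≡ ∣ R ∣R ⇔ (R ⊆R S ⊎ R ⊆R (S ⁺))
M≡∣∣R⇔⊆R⊎⊆R⁺ R S with ≤-<-connex (len R) (len S)
... | inj₁ lR≤lS = begin
  M R S ≡ ∣ R ∣R              ≈⟨ ≡-congˡ-⇔ (M-≤ R S lR≤lS) ⟩
  ∣ R ∩ S ∣R ≡ ∣ R ∣R         ≈⟨ ∣∩∣R≡∣∣R⇔⊆R R S ⟩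
  R ⊆R S                      ≈⟨ mk⇔ inj₁ [ id , (λ R⊆S⁺ → ⊆R-later⇒empty R (S ⁺) S R⊆S⁺ (s≤s lR≤lS)) ]′ ⟩
  (R ⊆R S ⊎ R ⊆R (S ⁺))       ∎
  where open ⇔-Reasoning
... | inj₂ lS<lR = begin
  M R S ≡ ∣ R ∣R              ≈⟨ ≡-congˡ-⇔ (M-> R S lS<lR) ⟩
  ∣ R ∩ (S ⁺) ∣R ≡ ∣ R ∣R     ≈⟨ ∣∩∣R≡∣∣R⇔⊆R R (S ⁺) ⟩
  R ⊆R (S ⁺)                  ≈⟨ mk⇔ inj₂ [ ⊆R⇒⊆R⁺ R S lS<lR , id ]′ ⟩
  (R ⊆R S ⊎ R ⊆R (S ⁺))       ∎
  where open ⇔-Reasoning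

M≡∣∣R⇔⊆R⊎⊆R⁻ : ∀ R S → M S R ≡ ∣ R ∣R ⇔ (R ⊆R S ⊎ R ⊆R (S ⁻))
M≡∣∣R⇔⊆R⊎⊆R⁻ R S with ≤-<-connex (len S) (len R)
... | inj₁ lS≤lR = begin
  M S R ≡ ∣ R ∣R              ≈⟨ ≡-congˡ-⇔ (trans (M-≤ S R lS≤lR) (∣∩∣R-comm S R)) ⟩
  ∣ R ∩ S ∣R ≡ ∣ R ∣R         ≈⟨ ∣∩∣R≡∣∣R⇔⊆R R S ⟩
  R ⊆R S                      ≈⟨ mk⇔ inj₁ [ id , ⊆R⁻⇒⊆R R S lS≤lR ]′ ⟩
  (R ⊆R S ⊎ R ⊆R (S ⁻))       ∎
  where open ⇔-Reasoning
... | inj₂ lR<lS = begin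
  M S R ≡ ∣ R ∣R              ≈⟨ ≡-congˡ-⇔ (trans (M-> S R lR<lS) (∣∩∣R-comm S (R ⁺))) ⟩
  ∣ R ⁺ ∩ S ∣R ≡ ∣ R ∣R       ≈⟨ ≡-congʳ-⇔ (∣⁺∣R R) ⟨
  ∣ R ⁺ ∩ S ∣R ≡ ∣ R ⁺ ∣R     ≈⟨ ∣∩∣R≡∣∣R⇔⊆R (R ⁺) S ⟩
  (R ⁺) ⊆R S                  ≈⟨ ⁺⊆R⇔⊆R⁻ R S ⟩
  R ⊆R (S ⁻)                  ≈⟨ mk⇔ inj₂ [ (λ R⊆S → ⊆R-later⇒empty R S (S ⁻) R⊆S lR<lS) , id ]′ ⟩
  (R ⊆R S ⊎ R ⊆R (S ⁻))       ∎
  where open ⇔-Reasoning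

M≡∣∣R×M≡∣∣R⇔⊆R : ∀ R S → (M R S ≡ ∣ R ∣R × M S R ≡ ∣ R ∣R) ⇔ R ⊆R S
M≡∣∣R×M≡∣∣R⇔⊆R R S = mk⇔ ⇒ (λ R⊆S → from (M≡∣∣R⇔⊆R⊎⊆R⁺ R S) (inj₁ R⊆S) , from (M≡∣∣R⇔⊆R⊎⊆R⁻ R S) (inj₁ R⊆S))
  where
  ⇒ : M R S ≡ ∣ R ∣R × M S R ≡ ∣ R ∣R → R ⊆R S
  ⇒ (eqʳ , eqˡ) with to (M≡∣∣R⇔⊆R⊎⊆R⁺ R S) eqʳ | to (M≡∣∣R⇔⊆R⊎⊆R⁻ R S) eqˡ
  ... | inj₁ R⊆S    | _            = R⊆S
  ... | _           | inj₁ R⊆S     = R⊆S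
  ... | inj₂ R⊆S⁺   | inj₂ R⊆S⁻    = ⊆R⁺×⊆R⁻⇒⊆R R S R⊆S⁺ R⊆S⁻

module _ {n} (λs : HorizontalStrip n) {i j : Fin n} where

  Mᵢⱼ-< : toℕ i < toℕ j → Mᵢⱼ λs i j ≡ M (λs i) (λs j)
  Mᵢⱼ-< i<j with toℕ i ≤? toℕ j
  ... | yes _   = refl
  ... | no i≰j = contradiction (<⇒≤ i<j) i≰j

  Mᵢⱼ-> : toℕ j < toℕ i → Mᵢⱼ λs i j ≡ M (λs j) (λs i)
  Mᵢⱼ-> j<i with toℕ i ≤? toℕ j
  ... | yes i≤j = contradiction i≤j (<⇒≱ j<i)
  ... | no _    = refl

  Mᵢⱼ-either : Mᵢⱼ λs i j ≡ M (λs i) (λs j) ⊎ Mᵢⱼ λs i j ≡ M (λs j) (λs i)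
  Mᵢⱼ-either with toℕ i ≤? toℕ j
  ... | yes _ = inj₁ refl
  ... | no _  = inj₂ refl

≡×≡⇔≡×≡ : ∀ {a} {A : Set a} {m x y k : A} → m ≡ x ⊎ m ≡ y → (m ≡ k × x ≡ y) ⇔ (x ≡ k × y ≡ k)
≡×≡⇔≡×≡ (inj₁ refl) = mk⇔ (λ (m≡k , m≡y) → m≡k , trans (sym m≡y) m≡k) (λ (x≡k , y≡k) → x≡k , trans x≡k (sym y≡k))
≡×≡⇔≡×≡ (inj₂ refl) = mk⇔ (λ (m≡k , x≡m) → trans x≡m m≡k , m≡k) (λ (x≡k , y≡k) → y≡k , trans x≡k (sym y≡k))

proposition5p2 : (n : ℕ) (λs : HorizontalStrip n) (i j : Fin n) → i ≢ j →
    (toℕ i < toℕ j → (Prec λs i j ⇔ (λs i ⊆R λs j ⊎ λs i ⊆R (λs j ⁺))))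
    × (toℕ j < toℕ i → (Prec λs i j ⇔ (λs i ⊆R λs j ⊎ λs i ⊆R (λs j ⁻))))
    × ((Prec λs i j × (λs i ↔R λs j)) ⇔ λs i ⊆R λs j)
proposition5p2 n λs i j _ =
    (λ i<j → ⇔.trans (≡-congˡ-⇔ (Mᵢⱼ-< λs i<j)) (M≡∣∣R⇔⊆R⊎⊆R⁺ (λs i) (λs j)))
  , (λ j<i → ⇔.trans (≡-congˡ-⇔ (Mᵢⱼ-> λs j<i)) (M≡∣∣R⇔⊆R⊎⊆R⁻ (λs i) (λs j)))
  , ⇔.trans (≡×≡⇔≡×≡ (Mᵢⱼ-either λs)) (M≡∣∣R×M≡∣∣R⇔⊆R (λs i) (λs j))
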